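{- Let $n$ be even and let $I$ be a subgraph of $C^{e}_{4,n}$ with $\ell\le n/10$ edges and $c$ components. Then \[|V(I)|-c\ge \frac{2}{3}\ell+\frac{c}{3}.\]
   Context: For even $n\ge 6$, $C^{e}_{4,n}$ is the graph on vertices $v_1,\dots,v_n$ with edges $v_{2i-1}v_{2i}$ ($i\in\{1,\dots,n/2\}$), the cycle $v_1v_3\cdots v_{n-1}v_1$ on the odd-indexed vertices and the cycle $v_2v_4\cdots v_nv_2$ on the even-indexed vertices; it is $3$-regular with $3n/2$ edges. A subgraph $I$ is identified with its edge set; $V(I)$ is the set of vertices incident to edges of $I$, and $c$ counts the connected components of $I$ (each containing at least one edge). -}

module Defs where

open import Data.Nat using (ℕ; zero; suc; _+_; _*_; _∸_; _<ᵇ_; _≡ᵇ_)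
open import Data.Bool using (Bool; true; false; _∧_; _∨_; not; if_then_else_)
open import Data.Fin using (Fin; toℕ)
open import Data.Fin.Subset using (Subset)
open import Data.Vec using (lookup)
open import Data.List using (List; upTo; length; filterᵇ; allFin)
open import Data.Bool.ListAction using (any)
open import Data.Product using (_×_; _,_; proj₁; proj₂)

-- Throughout, m ≥ 3 and n = 2 * m.  Vertex v_{k+1} of the paper is the
-- natural number k (0 ≤ k < n); so v_{2i-1} ↦ 2i-2 (even), v_{2i} ↦ 2i-1.

wrap : ℕ → ℕ → ℕ
wrap n x = if x <ᵇ n then x else x ∸ n

-- The 3m edges of C^e_{4,n}, indexed by Fin (3 * m):
--   index j < m       : the rung  {2j, 2j+1}          (paper: v_{2i-1} v_{2i}, i = j+1)
--   index j = m + k   : the cycle edge {k, (k+2) mod n}, 0 ≤ k < n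
--     (k even: edges of the cycle on v_1 v_3 … v_{n-1} v_1;
--      k odd : edges of the cycle on v_2 v_4 … v_n v_2)
endpoints : (m : ℕ) → Fin (3 * m) → ℕ × ℕ
endpoints m j =
  if toℕ j <ᵇ m
  then (2 * toℕ j , suc (2 * toℕ j))
  else (toℕ j ∸ m , wrap (2 * m) (toℕ j ∸ m + 2))

-- A subgraph I is identified with its edge set: a subset of the edge indices.
EdgeSet : ℕ → Set
EdgeSet m = Subset (3 * m)

numEdges : (m : ℕ) → EdgeSet m → ℕ
numEdges m I = length (filterᵇ (lookup I) (allFin (3 * m)))

incident : (m : ℕ) → EdgeSet m → ℕ → Bool
incident m I v = any (λ j → lookup I j ∧ ((v ≡ᵇ proj₁ (endpoints m j)) ∨ (v ≡ᵇ proj₂ (endpoints m j))))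
                     (allFin (3 * m))

numVertices : (m : ℕ) → EdgeSet m → ℕ
numVertices m I = length (filterᵇ (incident m I) (upTo (2 * m)))

adjI : (m : ℕ) → EdgeSet m → ℕ → ℕ → Bool
adjI m I u v = any (λ j → lookup I j ∧
                      (((u ≡ᵇ proj₁ (endpoints m j)) ∧ (v ≡ᵇ proj₂ (endpoints m j))) ∨
                       ((u ≡ᵇ proj₂ (endpoints m j)) ∧ (v ≡ᵇ proj₁ (endpoints m j)))))
                   (allFin (3 * m))

reach : (m : ℕ) → EdgeSet m → ℕ → ℕ → ℕ → Bool
reach m I zero    u v = u ≡ᵇ v
reach m I (suc k) u v = reach m I k u v ∨ any (λ w → reach m I k u w ∧ adjI m I w v) (upTo (2 * m))

-- u, v connected in I (walks of length ≤ n suffice since there are n vertices)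
connected : (m : ℕ) → EdgeSet m → ℕ → ℕ → Bool
connected m I u v = reach m I (2 * m) u v

-- c: number of connected components of I (each containing an edge), counted
-- via their least vertex: v ∈ V(I) such that no w < v is connected to v.
numComponents : (m : ℕ) → EdgeSet m → ℕ
numComponents m I =
  length (filterᵇ (λ v → incident m I v ∧ not (any (λ w → connected m I w v) (upTo v)))
                  (upTo (2 * m)))

{-# OPTIONS --safe #-}
module Submission where

-- C^e_{4,n} is the circular ladder with m = n/2 columns {v_{2i-1}, v_{2i}}: each column carries a
-- rung, and consecutive columns are joined by a rail in each row.  When ℓ < m (all that ℓ ≤ n/10 is
-- used for), some column has no rail to its right neighbour, so inside a component one can walk to
-- the left (to the right) until the component ends there; a rule looking only at the edges around
-- one column marks such left (right) ends.  Every component contains a left end and a right end and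
-- distinct components are disjoint, so c is at most the number of left ends and at most the number
-- of right ends.  Splitting every rail between its two columns, a check of the 32 configurations of
-- a column gives 2 · #left ends + 2 · #right ends + 2ℓ ≤ 3|V(I)|, whence 2ℓ + 4c ≤ 3|V(I)|.

open import Defs
open import Data.Nat using (ℕ; zero; suc; _+_; _*_; _∸_; _≤_; _<_; z≤n; s≤s; z<s; s<s; _<ᵇ_; _≤ᵇ_; _≡ᵇ_; _≤?_; _<?_)
open import Data.Nat.Properties
open import Algebra.Properties.CommutativeSemigroup +-commutativeSemigroup using (interchange)
open import Data.Bool using (Bool; true; false; _∧_; _∨_; not; if_then_else_; T)
open import Data.Bool.Properties using (∨-comm; ∨-assoc; ∨-idem; ∨-zeroʳ; ∨-identityʳ; ∧-comm; ∧-identityʳ; T-≡; T-∧)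
open import Data.Bool.ListAction using (any)
open import Data.Fin using (Fin; toℕ) renaming (zero to fzero; suc to fsuc)
open import Data.Vec using (Vec; []; _∷_; lookup)
open import Data.List using ([]; _∷_; upTo; length; filterᵇ; allFin; applyUpTo; tabulate)
open import Data.Product using (Σ; _×_; _,_; proj₁; proj₂)
open import Data.Sum using (_⊎_; inj₁; inj₂; [_,_]′)
open import Data.Empty using (⊥-elim)
open import Function using (_∘_; id)
open import Function.Bundles using (Equivalence)
open import Relation.Binary using (tri<; tri≈; tri>)
open import Relation.Binary.PropositionalEquality
open import Relation.Nullary using (yes; no; ¬_)

true≢false : true ≢ false
true≢false ()

∨-introˡ : ∀ {a} b → a ≡ true → a ∨ b ≡ true
∨-introˡ b refl = refl

∨-introʳ : ∀ a {b} → b ≡ true → a ∨ b ≡ true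
∨-introʳ a refl = ∨-zeroʳ a

∨-elim : ∀ a b → a ∨ b ≡ true → a ≡ true ⊎ b ≡ true
∨-elim true  b _ = inj₁ refl
∨-elim false b e = inj₂ e

∧-intro : ∀ {a b} → a ≡ true → b ≡ true → a ∧ b ≡ true
∧-intro refl refl = refl

∧-elim : ∀ a b → a ∧ b ≡ true → a ≡ true × b ≡ true
∧-elim true true _ = refl , refl

∧-not-intro : ∀ {a b} → a ≡ true → b ≡ false → a ∧ not b ≡ true
∧-not-intro refl refl = refl

not-true : ∀ {b} → not b ≡ true → b ≡ false
not-true {false} _ = refl

true-or-false : ∀ b → b ≡ true ⊎ b ≡ false
true-or-false true  = inj₁ refl
true-or-false false = inj₂ refl

≡true-ext : ∀ a b → (a ≡ true → b ≡ true) → (b ≡ true → a ≡ true) → a ≡ b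
≡true-ext true  b f _ = sym (f refl)
≡true-ext false true  _ g = g refl
≡true-ext false false _ _ = refl

≡ᵇ-refl : ∀ k → (k ≡ᵇ k) ≡ true
≡ᵇ-refl k = Equivalence.to T-≡ (≡⇒≡ᵇ k k refl)

≡ᵇ-true⇒≡ : ∀ {k t} → (k ≡ᵇ t) ≡ true → k ≡ t
≡ᵇ-true⇒≡ {k} {t} e = ≡ᵇ⇒≡ k t (Equivalence.from T-≡ e)

<⇒<ᵇ-true : ∀ {a b} → a < b → (a <ᵇ b) ≡ true
<⇒<ᵇ-true a<b = Equivalence.to T-≡ (<⇒<ᵇ a<b)

≮⇒<ᵇ-false : ∀ {a b} → ¬ (a < b) → (a <ᵇ b) ≡ false
≮⇒<ᵇ-false {a} {b} a≮b with a <ᵇ b in e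
... | false = refl
... | true  = ⊥-elim (a≮b (<ᵇ⇒< a b (Equivalence.from T-≡ e)))

allBool : (Bool → Bool) → Bool
allBool p = p false ∧ p true

allBool-sound : ∀ p → T (allBool p) → ∀ b → T (p b)
allBool-sound p t false = proj₁ (Equivalence.to T-∧ t)
allBool-sound p t true  = proj₂ (Equivalence.to T-∧ t)

≤-by-exhaustion : ∀ (f g : Bool → Bool → Bool → Bool → Bool → ℕ) →
  T (allBool λ a → allBool λ b → allBool λ c → allBool λ d → allBool λ e → f a b c d e ≤ᵇ g a b c d e) →
  ∀ a b c d e → f a b c d e ≤ g a b c d e
≤-by-exhaustion f g t a b c d e = ≤ᵇ⇒≤ _ _
  (allBool-sound (p a b c d)
    (allBool-sound (p₄ a b c) (allBool-sound (p₃ a b) (allBool-sound (p₂ a) (allBool-sound p₁ t a) b) c) d) e)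
  where
  p : Bool → Bool → Bool → Bool → Bool → Bool
  p a b c d e = f a b c d e ≤ᵇ g a b c d e
  p₄ : Bool → Bool → Bool → Bool → Bool
  p₄ a b c d = allBool (p a b c d)
  p₃ : Bool → Bool → Bool → Bool
  p₃ a b c = allBool (p₄ a b c)
  p₂ : Bool → Bool → Bool
  p₂ a b = allBool (p₃ a b)
  p₁ : Bool → Bool
  p₁ a = allBool (p₂ a)

𝟙 : Bool → ℕ
𝟙 true  = 1
𝟙 false = 0

𝟙≤1 : ∀ b → 𝟙 b ≤ 1
𝟙≤1 true  = s≤s z≤n
𝟙≤1 false = z≤n

𝟙-mono : ∀ a b → (a ≡ true → b ≡ true) → 𝟙 a ≤ 𝟙 b
𝟙-mono false b _ = z≤n
𝟙-mono true  b h rewrite h refl = s≤s z≤n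

𝟙+𝟙≡0 : ∀ a b → 𝟙 a + 𝟙 b ≡ 0 → a ≡ false × b ≡ false
𝟙+𝟙≡0 false false _ = refl , refl

sumBelow : (ℕ → ℕ) → ℕ → ℕ
sumBelow f zero    = 0
sumBelow f (suc n) = f 0 + sumBelow (f ∘ suc) n

countBelow : (ℕ → Bool) → ℕ → ℕ
countBelow p = sumBelow (𝟙 ∘ p)

anyBelow : (ℕ → Bool) → ℕ → Bool
anyBelow p zero    = false
anyBelow p (suc n) = p 0 ∨ anyBelow (p ∘ suc) n

-- Out of range, `at` reads false.
at : ∀ {n} → Vec Bool n → ℕ → Bool
at []      k       = false
at (b ∷ v) zero    = b
at (b ∷ v) (suc k) = at v k

sumBelow-cong : ∀ f g n → (∀ k → k < n → f k ≡ g k) → sumBelow f n ≡ sumBelow g n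
sumBelow-cong f g zero    h = refl
sumBelow-cong f g (suc n) h = cong₂ _+_ (h 0 z<s) (sumBelow-cong (f ∘ suc) (g ∘ suc) n (λ k k<n → h (suc k) (s<s k<n)))

sumBelow-mono : ∀ f g n → (∀ k → k < n → f k ≤ g k) → sumBelow f n ≤ sumBelow g n
sumBelow-mono f g zero    h = z≤n
sumBelow-mono f g (suc n) h = +-mono-≤ (h 0 z<s) (sumBelow-mono (f ∘ suc) (g ∘ suc) n (λ k k<n → h (suc k) (s<s k<n)))

sumBelow-+ : ∀ f g n → sumBelow (λ k → f k + g k) n ≡ sumBelow f n + sumBelow g n
sumBelow-+ f g zero    = refl
sumBelow-+ f g (suc n) =
  trans (cong (f 0 + g 0 +_) (sumBelow-+ (f ∘ suc) (g ∘ suc) n)) (interchange (f 0) (g 0) _ _)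

sumBelow-* : ∀ c f n → sumBelow (λ k → c * f k) n ≡ c * sumBelow f n
sumBelow-* c f zero    = sym (*-zeroʳ c)
sumBelow-* c f (suc n) = trans (cong (c * f 0 +_) (sumBelow-* c (f ∘ suc) n)) (sym (*-distribˡ-+ c (f 0) _))

sumBelow-split : ∀ f a b → sumBelow f (a + b) ≡ sumBelow f a + sumBelow (λ k → f (a + k)) b
sumBelow-split f zero    b = refl
sumBelow-split f (suc a) b = trans (cong (f 0 +_) (sumBelow-split (f ∘ suc) a b)) (sym (+-assoc (f 0) _ _))

sumBelow-last : ∀ f n → sumBelow f (suc n) ≡ sumBelow f n + f n
sumBelow-last f zero    = +-identityʳ (f 0)
sumBelow-last f (suc n) = trans (cong (f 0 +_) (sumBelow-last (f ∘ suc) n)) (sym (+-assoc (f 0) _ _))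

small-sum⇒zero-term : ∀ g n → sumBelow g n < n → Σ ℕ λ i → i < n × g i ≡ 0
small-sum⇒zero-term g (suc n) lt with g 0 in e
... | zero  = 0 , z<s , e
... | suc x with small-sum⇒zero-term (g ∘ suc) n (≤-trans (s≤s (m≤n+m _ x)) (≤-pred lt))
...   | i , i<n , gi = suc i , s<s i<n , gi

countBelow-≤ : ∀ p n → countBelow p n ≤ n
countBelow-≤ p zero    = z≤n
countBelow-≤ p (suc n) = +-mono-≤ (𝟙≤1 (p 0)) (countBelow-≤ (p ∘ suc) n)

countBelow-mono : ∀ p q n → (∀ k → k < n → p k ≡ true → q k ≡ true) → countBelow p n ≤ countBelow q n
countBelow-mono p q n h = sumBelow-mono _ _ n (λ k k<n → 𝟙-mono (p k) (q k) (h k k<n))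

countBelow-remove : ∀ q n t → t < n → q t ≡ true →
  countBelow q n ≡ suc (countBelow (λ k → q k ∧ not (k ≡ᵇ t)) n)
countBelow-remove q (suc n) zero _ qt rewrite qt =
  cong suc (sumBelow-cong _ _ n (λ k _ → cong 𝟙 (sym (∧-identityʳ (q (suc k))))))
countBelow-remove q (suc n) (suc t) (s<s t<n) qt rewrite ∧-identityʳ (q 0) =
  trans (cong (𝟙 (q 0) +_) (countBelow-remove (q ∘ suc) n t t<n qt)) (+-suc (𝟙 (q 0)) _)

countBelow-pos : ∀ p n t → t < n → p t ≡ true → 1 ≤ countBelow p n
countBelow-pos p n t t<n pt rewrite countBelow-remove p n t t<n pt = s≤s z≤n

⊆-with-equal-count⇒⊇ : ∀ p q n → countBelow p n ≡ countBelow q n →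
  (∀ k → k < n → p k ≡ true → q k ≡ true) → ∀ k → k < n → q k ≡ true → p k ≡ true
⊆-with-equal-count⇒⊇ p q (suc n) e p⊆q k k<n qk with p 0 in p0 | q 0 in q0
... | false | true  = ⊥-elim (<-irrefl e (s≤s (countBelow-mono (p ∘ suc) (q ∘ suc) n (λ k k<n → p⊆q (suc k) (s<s k<n)))))
... | true  | false = ⊥-elim (true≢false (trans (sym (p⊆q 0 z<s p0)) q0))
⊆-with-equal-count⇒⊇ p q (suc n) e p⊆q zero    k<n qk | true  | true  = p0
⊆-with-equal-count⇒⊇ p q (suc n) e p⊆q zero    k<n qk | false | false = ⊥-elim (true≢false (trans (sym qk) q0))
⊆-with-equal-count⇒⊇ p q (suc n) e p⊆q (suc k) (s<s k<n) qk | true | true =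
  ⊆-with-equal-count⇒⊇ (p ∘ suc) (q ∘ suc) n (suc-injective e) (λ k k<n → p⊆q (suc k) (s<s k<n)) k k<n qk
⊆-with-equal-count⇒⊇ p q (suc n) e p⊆q (suc k) (s<s k<n) qk | false | false =
  ⊆-with-equal-count⇒⊇ (p ∘ suc) (q ∘ suc) n e (λ k k<n → p⊆q (suc k) (s<s k<n)) k k<n qk

InjectiveBelow : (ℕ → Bool) → ℕ → (ℕ → ℕ → Set) → Set
InjectiveBelow P n R = ∀ v w t → v < n → w < n → P v ≡ true → P w ≡ true → R v t → R w t → v ≡ w

InjectiveBelow-pred : ∀ {P n R} → InjectiveBelow P (suc n) R → InjectiveBelow P n R
InjectiveBelow-pred unique v w t v<n w<n = unique v w t (m≤n⇒m≤1+n v<n) (m≤n⇒m≤1+n w<n)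

countBelow-injection : ∀ (P Q : ℕ → Bool) n N (R : ℕ → ℕ → Set) →
  (∀ v → v < n → P v ≡ true → Σ ℕ λ t → t < N × Q t ≡ true × R v t) →
  InjectiveBelow P n R →
  countBelow P n ≤ countBelow Q N
countBelow-injection P Q zero    N R witness unique = z≤n
countBelow-injection P Q (suc n) N R witness unique rewrite sumBelow-last (𝟙 ∘ P) n with P n in Pn
... | false = subst (_≤ countBelow Q N) (sym (+-identityʳ _))
                (countBelow-injection P Q n N R (λ v v<n → witness v (m≤n⇒m≤1+n v<n)) (InjectiveBelow-pred unique))
... | true with witness n ≤-refl Pn
...   | t , t<N , Qt , Rnt =
  subst (_≤ countBelow Q N) (+-comm 1 _)
    (subst (suc (countBelow P n) ≤_) (sym (countBelow-remove Q N t t<N Qt))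
      (s≤s (countBelow-injection P Q′ n N R witness′ (InjectiveBelow-pred unique))))
  where
  Q′ : ℕ → Bool
  Q′ k = Q k ∧ not (k ≡ᵇ t)
  witness′ : ∀ v → v < n → P v ≡ true → Σ ℕ λ t′ → t′ < N × Q′ t′ ≡ true × R v t′
  witness′ v v<n Pv with witness v (m≤n⇒m≤1+n v<n) Pv
  ... | tv , tv<N , Qtv , Rvtv with tv ≡ᵇ t in tv≡t
  ...   | false = tv , tv<N , ∧-not-intro Qtv tv≡t , Rvtv
  ...   | true  = ⊥-elim (<-irrefl (unique v n t (m≤n⇒m≤1+n v<n) ≤-refl Pv Pn
                                      (subst (R v) (≡ᵇ-true⇒≡ tv≡t) Rvtv) Rnt) v<n)

anyBelow-intro : ∀ p n k → k < n → p k ≡ true → anyBelow p n ≡ true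
anyBelow-intro p (suc n) zero    _         pk = ∨-introˡ _ pk
anyBelow-intro p (suc n) (suc k) (s<s k<n) pk = ∨-introʳ (p 0) (anyBelow-intro (p ∘ suc) n k k<n pk)

anyBelow-elim : ∀ p n → anyBelow p n ≡ true → Σ ℕ λ k → k < n × p k ≡ true
anyBelow-elim p (suc n) e with ∨-elim (p 0) _ e
... | inj₁ p0 = 0 , z<s , p0
... | inj₂ e′ with anyBelow-elim (p ∘ suc) n e′
...   | k , k<n , pk = suc k , s<s k<n , pk

anyBelow-cong : ∀ p q n → (∀ k → k < n → p k ≡ q k) → anyBelow p n ≡ anyBelow q n
anyBelow-cong p q zero    h = refl
anyBelow-cong p q (suc n) h = cong₂ _∨_ (h 0 z<s) (anyBelow-cong (p ∘ suc) (q ∘ suc) n (λ k k<n → h (suc k) (s<s k<n)))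

length-filterᵇ-applyUpTo : ∀ (p : ℕ → Bool) f n → length (filterᵇ p (applyUpTo f n)) ≡ countBelow (p ∘ f) n
length-filterᵇ-applyUpTo p f zero = refl
length-filterᵇ-applyUpTo p f (suc n) with p (f 0)
... | true  = cong suc (length-filterᵇ-applyUpTo p (f ∘ suc) n)
... | false = length-filterᵇ-applyUpTo p (f ∘ suc) n

any-applyUpTo : ∀ (p : ℕ → Bool) f n → any p (applyUpTo f n) ≡ anyBelow (p ∘ f) n
any-applyUpTo p f zero    = refl
any-applyUpTo p f (suc n) = cong (p (f 0) ∨_) (any-applyUpTo p (f ∘ suc) n)

length-filterᵇ-tabulate : ∀ {A : Set} {n} (p : A → Bool) (f : Fin n → A) (v : Vec Bool n) →
  (∀ j → p (f j) ≡ lookup v j) → length (filterᵇ p (tabulate f)) ≡ countBelow (at v) n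
length-filterᵇ-tabulate p f []      h = refl
length-filterᵇ-tabulate p f (b ∷ v) h with p (f fzero) | h fzero
... | true  | refl = cong suc (length-filterᵇ-tabulate p (f ∘ fsuc) v (h ∘ fsuc))
... | false | refl = length-filterᵇ-tabulate p (f ∘ fsuc) v (h ∘ fsuc)

any-cong : ∀ {A : Set} (p q : A → Bool) xs → (∀ x → p x ≡ q x) → any p xs ≡ any q xs
any-cong p q []       h = refl
any-cong p q (x ∷ xs) h = cong₂ _∨_ (h x) (any-cong p q xs h)

any-tabulate : ∀ {A : Set} {n} (p : A → Bool) (f : Fin n → A) (v : Vec Bool n) (F : ℕ → Bool) →
  (∀ j → p (f j) ≡ lookup v j ∧ F (toℕ j)) → any p (tabulate f) ≡ anyBelow (λ k → at v k ∧ F k) n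
any-tabulate p f []      F h = refl
any-tabulate p f (b ∷ v) F h = cong₂ _∨_ (h fzero) (any-tabulate p (f ∘ fsuc) v (F ∘ suc) (h ∘ fsuc))

module Reachability (m : ℕ) (I : EdgeSet m) where

  reach-suc : ∀ k u v → reach m I k u v ≡ true → reach m I (suc k) u v ≡ true
  reach-suc k u v = ∨-introˡ _

  reach-+ : ∀ d k u v → reach m I k u v ≡ true → reach m I (d + k) u v ≡ true
  reach-+ zero    k u v r = r
  reach-+ (suc d) k u v r = reach-suc (d + k) u v (reach-+ d k u v r)

  reach-step : ∀ k u w v → reach m I k u w ≡ true → w < 2 * m → adjI m I w v ≡ true →
    reach m I (suc k) u v ≡ true
  reach-step k u w v r w<2m a = ∨-introʳ (reach m I k u v)
    (trans (any-applyUpTo _ id (2 * m)) (anyBelow-intro _ (2 * m) w w<2m (∧-intro r a)))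

  reach-suc-cases : ∀ k u v → reach m I (suc k) u v ≡ true →
    reach m I k u v ≡ true ⊎ Σ ℕ λ w → w < 2 * m × reach m I k u w ≡ true × adjI m I w v ≡ true
  reach-suc-cases k u v e with ∨-elim (reach m I k u v) _ e
  ... | inj₁ r = inj₁ r
  ... | inj₂ a with anyBelow-elim _ (2 * m) (trans (sym (any-applyUpTo _ id (2 * m))) a)
  ...   | w , w<2m , rw = inj₂ (w , w<2m , ∧-elim _ _ rw)

  reach-trans : ∀ a b u w v → reach m I a u w ≡ true → reach m I b w v ≡ true → reach m I (b + a) u v ≡ true
  reach-trans a zero    u w v r₁ r₂ rewrite ≡ᵇ-true⇒≡ {w} {v} r₂ = r₁
  reach-trans a (suc b) u w v r₁ r₂ with reach-suc-cases b w v r₂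
  ... | inj₁ r = reach-suc (b + a) u v (reach-trans a b u w v r₁ r)
  ... | inj₂ (x , x<2m , r , e) = reach-step (b + a) u x v (reach-trans a b u w x r₁ r) x<2m e

  adjI-sym : ∀ u v → adjI m I u v ≡ adjI m I v u
  adjI-sym u v = any-cong _ _ (allFin (3 * m)) λ j → cong (lookup I j ∧_) (swap
    (u ≡ᵇ proj₁ (endpoints m j)) (v ≡ᵇ proj₂ (endpoints m j)) (u ≡ᵇ proj₂ (endpoints m j)) (v ≡ᵇ proj₁ (endpoints m j)))
    where
    swap : ∀ a b c d → (a ∧ b) ∨ (c ∧ d) ≡ (d ∧ c) ∨ (b ∧ a)
    swap a b c d = trans (cong₂ _∨_ (∧-comm a b) (∧-comm c d)) (∨-comm (b ∧ a) (d ∧ c))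

  reach-cons : ∀ k u′ u v → adjI m I u′ u ≡ true → u′ < 2 * m → reach m I k u v ≡ true → reach m I (suc k) u′ v ≡ true
  reach-cons k u′ u v a u′<2m r = subst (λ z → reach m I z u′ v ≡ true) (+-comm k 1)
    (reach-trans 1 k u′ u v (reach-step 0 u′ u′ u (≡ᵇ-refl u′) u′<2m a) r)

  reach-sym : ∀ k u v → u < 2 * m → v < 2 * m → reach m I k u v ≡ true → reach m I k v u ≡ true
  reach-sym zero    u v u<2m v<2m r rewrite ≡ᵇ-true⇒≡ {u} {v} r = ≡ᵇ-refl v
  reach-sym (suc k) u v u<2m v<2m r with reach-suc-cases k u v r
  ... | inj₁ r′ = reach-suc k v u (reach-sym k u v u<2m v<2m r′)
  ... | inj₂ (x , x<2m , r′ , e) = reach-cons k v x u (trans (adjI-sym v x) e) v<2m (reach-sym k u x u<2m x<2m r′)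

  Connected : ℕ → ℕ → Set
  Connected u v = Σ ℕ λ k → reach m I k u v ≡ true

  Connected-refl : ∀ u → Connected u u
  Connected-refl u = 0 , ≡ᵇ-refl u

  Connected-sym : ∀ {u v} → u < 2 * m → v < 2 * m → Connected u v → Connected v u
  Connected-sym {u} {v} u<2m v<2m (k , r) = k , reach-sym k u v u<2m v<2m r

  Connected-trans : ∀ {u w v} → Connected u w → Connected w v → Connected u v
  Connected-trans {u} {w} {v} (a , r₁) (b , r₂) = b + a , reach-trans a b u w v r₁ r₂

  adjI⇒Connected : ∀ {u v} → u < 2 * m → adjI m I u v ≡ true → Connected u v
  adjI⇒Connected {u} {v} u<2m a = 1 , reach-step 0 u u v (≡ᵇ-refl u) u<2m a

  -- The vertices reachable within k steps form a growing family of subsets of [0, 2m): it grows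
  -- strictly until it stops changing, hence it is final after 2m steps.
  module Saturation (u : ℕ) (u<2m : u < 2 * m) where

    size : ℕ → ℕ
    size k = countBelow (reach m I k u) (2 * m)

    Saturated : ℕ → Set
    Saturated k = ∀ j v → reach m I j u v ≡ true → reach m I k u v ≡ true

    Stable : ℕ → Set
    Stable k = ∀ w → w < 2 * m → reach m I (suc k) u w ≡ reach m I k u w

    stable-suc : ∀ k → Stable k → ∀ v → reach m I (suc (suc k)) u v ≡ reach m I (suc k) u v
    stable-suc k stable v = begin
      reach m I (suc k) u v ∨ any (λ w → reach m I (suc k) u w ∧ adjI m I w v) (upTo (2 * m))
        ≡⟨ cong (reach m I (suc k) u v ∨_) (trans (any-applyUpTo _ id (2 * m))
             (trans (anyBelow-cong _ _ (2 * m) (λ w w<2m → cong (_∧ adjI m I w v) (stable w w<2m)))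
                    (sym (any-applyUpTo _ id (2 * m))))) ⟩
      (reach m I k u v ∨ step) ∨ step
        ≡⟨ trans (∨-assoc (reach m I k u v) step step) (cong (reach m I k u v ∨_) (∨-idem step)) ⟩
      reach m I (suc k) u v ∎
      where
      open ≡-Reasoning
      step : Bool
      step = any (λ w → reach m I k u w ∧ adjI m I w v) (upTo (2 * m))

    stable⇒saturated : ∀ k → Stable k → Saturated (suc k)
    stable⇒saturated k stable j v r =
      trans (sym (settled j v)) (subst (λ z → reach m I z u v ≡ true) (+-comm (suc k) j) (reach-+ (suc k) j u v r))
      where
      settled-suc : ∀ d v → reach m I (suc (d + suc k)) u v ≡ reach m I (d + suc k) u v
      settled-suc zero    v = stable-suc k stable v
      settled-suc (suc d) v = stable-suc (d + suc k) (λ w _ → settled-suc d w) v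
      settled : ∀ d v → reach m I (d + suc k) u v ≡ reach m I (suc k) u v
      settled zero    v = refl
      settled (suc d) v = trans (settled-suc d v) (settled d v)

    grows-or-saturated : ∀ k → suc k ≤ size k ⊎ Saturated k
    grows-or-saturated zero = inj₁ (countBelow-pos (reach m I 0 u) (2 * m) u u<2m (≡ᵇ-refl u))
    grows-or-saturated (suc k) with grows-or-saturated k
    ... | inj₂ saturated = inj₂ λ j v r → reach-suc k u v (saturated j v r)
    ... | inj₁ grown with size (suc k) ≤? size k
    ...   | no  ¬shrunk = inj₁ (≤-trans (s≤s grown) (≰⇒> ¬shrunk))
    ...   | yes shrunk  = inj₂ (stable⇒saturated k λ w w<2m → ≡true-ext _ _
              (⊆-with-equal-count⇒⊇ (reach m I k u) (reach m I (suc k) u) (2 * m) same-size grows w w<2m)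
              (reach-suc k u w))
      where
      grows : ∀ w → w < 2 * m → reach m I k u w ≡ true → reach m I (suc k) u w ≡ true
      grows w _ = reach-suc k u w
      same-size : size k ≡ size (suc k)
      same-size = ≤-antisym (countBelow-mono _ _ (2 * m) grows) shrunk

    saturated : Saturated (2 * m)
    saturated with grows-or-saturated (2 * m)
    ... | inj₁ grown    = ⊥-elim (<-irrefl refl (≤-trans grown (countBelow-≤ _ (2 * m))))
    ... | inj₂ saturated = saturated

  connected-complete : ∀ {u v} → u < 2 * m → Connected u v → connected m I u v ≡ true
  connected-complete {u} {v} u<2m (k , r) = Saturation.saturated u u<2m k v r

  isRepresentative : ℕ → Bool
  isRepresentative v = incident m I v ∧ not (any (λ w → connected m I w v) (upTo v))

  numComponents-count : numComponents m I ≡ countBelow isRepresentative (2 * m)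
  numComponents-count = length-filterᵇ-applyUpTo isRepresentative id (2 * m)

  ¬Connected-representative : ∀ {v w} → v < 2 * m → v < w → isRepresentative w ≡ true → ¬ Connected v w
  ¬Connected-representative {v} {w} v<2m v<w rep c = true≢false (trans (sym earlier) (not-true (proj₂ (∧-elim _ _ rep))))
    where
    earlier : any (λ x → connected m I x w) (upTo w) ≡ true
    earlier = trans (any-applyUpTo _ id w) (anyBelow-intro _ w v v<w (connected-complete v<2m c))

  representative-unique : ∀ {v w} → v < 2 * m → w < 2 * m →
    isRepresentative v ≡ true → isRepresentative w ≡ true → Connected v w → v ≡ w
  representative-unique {v} {w} v<2m w<2m rep-v rep-w c with <-cmp v w
  ... | tri< v<w _ _ = ⊥-elim (¬Connected-representative v<2m v<w rep-w c)
  ... | tri≈ _ v≡w _ = v≡w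
  ... | tri> _ _ w<v = ⊥-elim (¬Connected-representative w<2m w<v rep-v (Connected-sym v<2m w<2m c))

-- Column i of the ladder is {vertex false i, vertex true i} = {2i, 2i+1}, i.e. {v_{2i+1}, v_{2i+2}}
-- in the paper's numbering; the boolean selects the row.
vertex : Bool → ℕ → ℕ
vertex false i = 2 * i
vertex true  i = suc (2 * i)

vertex-suc : ∀ s i → vertex s (suc i) ≡ vertex s i + 2
vertex-suc false i = trans (*-distribˡ-+ 2 1 i) (+-comm 2 (2 * i))
vertex-suc true  i = cong suc (trans (*-distribˡ-+ 2 1 i) (+-comm 2 (2 * i)))

vertex-injective : ∀ s s′ i i′ → vertex s i ≡ vertex s′ i′ → s ≡ s′ × i ≡ i′
vertex-injective false false i i′ e = refl , *-cancelˡ-≡ i i′ 2 e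
vertex-injective false true  i i′ e = ⊥-elim (even≢odd i i′ e)
vertex-injective true  false i i′ e = ⊥-elim (even≢odd i′ i (sym e))
vertex-injective true  true  i i′ e = refl , *-cancelˡ-≡ i i′ 2 (suc-injective e)

vertex-split : ∀ v → Σ Bool λ s → Σ ℕ λ i → v ≡ vertex s i
vertex-split zero = false , 0 , refl
vertex-split (suc v) with vertex-split v
... | false , i , e = true  , i , cong suc e
... | true  , i , e = false , suc i , trans (cong suc e) (sym (*-distribˡ-+ 2 1 i))

vertex-< : ∀ {n} s i → i < n → vertex s i < 2 * n
vertex-< {n} s i i<n = ≤-trans (s≤s (≤-column s)) (subst (_≤ 2 * n) (*-distribˡ-+ 2 1 i) (*-monoʳ-≤ 2 i<n))
  where
  ≤-column : ∀ s → vertex s i ≤ suc (2 * i)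
  ≤-column false = n≤1+n _
  ≤-column true  = ≤-refl

vertex-<⁻ : ∀ {n} s i → vertex s i < 2 * n → i < n
vertex-<⁻ {n} s i lt = *-cancelˡ-< 2 i n (≤-<-trans (column-≤ s) lt)
  where
  column-≤ : ∀ s → 2 * i ≤ vertex s i
  column-≤ false = ≤-refl
  column-≤ true  = n≤1+n _

onVertices : (Bool → ℕ → Bool) → ℕ → Bool
onVertices P v = P (proj₁ (vertex-split v)) (proj₁ (proj₂ (vertex-split v)))

onVertices-vertex : ∀ P s i → onVertices P (vertex s i) ≡ P s i
onVertices-vertex P s i with vertex-split (vertex s i)
... | s′ , i′ , e with vertex-injective s s′ i i′ e
...   | refl , refl = refl

sumBelow-columns : ∀ f n → sumBelow f (2 * n) ≡ sumBelow (λ i → f (vertex false i) + f (vertex true i)) n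
sumBelow-columns f zero    = refl
sumBelow-columns f (suc n) = begin
  sumBelow f (2 * suc n)                                     ≡⟨ cong (sumBelow f) (*-distribˡ-+ 2 1 n) ⟩
  f 0 + (f 1 + sumBelow (f ∘ suc ∘ suc) (2 * n))             ≡⟨ sym (+-assoc (f 0) (f 1) _) ⟩
  f 0 + f 1 + sumBelow (f ∘ suc ∘ suc) (2 * n)               ≡⟨ cong (f 0 + f 1 +_) (sumBelow-columns (f ∘ suc ∘ suc) n) ⟩
  f 0 + f 1 + sumBelow (λ i → f (2 + vertex false i) + f (2 + vertex true i)) n
    ≡⟨ cong (f 0 + f 1 +_) (sumBelow-cong _ _ n λ i _ → cong₂ _+_
         (cong f (sym (vertex-suc′ false i))) (cong f (sym (vertex-suc′ true i)))) ⟩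
  sumBelow (λ i → f (vertex false i) + f (vertex true i)) (suc n) ∎
  where
  open ≡-Reasoning
  vertex-suc′ : ∀ s i → vertex s (suc i) ≡ 2 + vertex s i
  vertex-suc′ s i = trans (vertex-suc s i) (+-comm (vertex s i) 2)

countBelow-onVertices : ∀ P n → countBelow (onVertices P) (2 * n) ≡ sumBelow (λ i → 𝟙 (P false i) + 𝟙 (P true i)) n
countBelow-onVertices P n = trans (sumBelow-columns _ n) (sumBelow-cong _ _ n λ i _ →
  cong₂ _+_ (cong 𝟙 (onVertices-vertex P false i)) (cong 𝟙 (onVertices-vertex P true i)))

-- Around a column, a and b are the rails arriving from the left
-- (top and bottom row), r is the rung and c and d are the rails leaving to the right.  A vertex is a
-- left end if its component does not continue to the left from it; if the rung is present, both
-- vertices belong to one component and only the top one is marked.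
leftEndIn : Bool → Bool → Bool → Bool → Bool → Bool → Bool
leftEndIn false a b r c d = if r then not a ∧ not b else not a ∧ c
leftEndIn true  a b r c d = if r then false else not b ∧ d

rightEndIn : Bool → Bool → Bool → Bool → Bool → Bool → Bool
rightEndIn s a b r c d = leftEndIn s c d r a b

column-inequality : ∀ a b r c d →
  2 * (𝟙 (leftEndIn false a b r c d) + 𝟙 (leftEndIn true a b r c d)) +
  2 * (𝟙 (rightEndIn false a b r c d) + 𝟙 (rightEndIn true a b r c d)) +
  (2 * 𝟙 r + (𝟙 a + 𝟙 b) + (𝟙 c + 𝟙 d))
  ≤ 3 * (𝟙 (a ∨ r ∨ c) + 𝟙 (b ∨ r ∨ d))
column-inequality = ≤-by-exhaustion _ _ _

-- With m = suc m′ the predecessor of column 0 is the last column m′ by computation.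
module Ladder (m′ : ℕ) (I : EdgeSet (suc m′)) where

  m : ℕ
  m = suc m′

  open Reachability m I

  next : ℕ → ℕ
  next i = if suc i <ᵇ m then suc i else 0

  prev : ℕ → ℕ
  prev zero    = m′
  prev (suc i) = i

  next-< : ∀ i → i < m → next i < m
  next-< i i<m with suc i <? m
  ... | yes lt rewrite <⇒<ᵇ-true lt = lt
  ... | no ¬lt rewrite ≮⇒<ᵇ-false ¬lt = z<s

  prev-< : ∀ i → i < m → prev i < m
  prev-< zero    _  = ≤-refl
  prev-< (suc i) lt = ≤-trans (n≤1+n _) lt

  next-prev : ∀ i → i < m → next (prev i) ≡ i
  next-prev zero    _  rewrite ≮⇒<ᵇ-false {m} {m} (<-irrefl refl) = refl
  next-prev (suc i) lt rewrite <⇒<ᵇ-true lt = refl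

  last-column : ∀ i → i < m → ¬ (suc i < m) → i ≡ m′
  last-column i i<m ¬lt = ≤-antisym (≤-pred i<m) (≤-pred (≮⇒≥ ¬lt))

  prev-next : ∀ i → i < m → prev (next i) ≡ i
  prev-next i i<m with suc i <? m
  ... | yes lt rewrite <⇒<ᵇ-true lt = refl
  ... | no ¬lt rewrite ≮⇒<ᵇ-false ¬lt = sym (last-column i i<m ¬lt)

  sumBelow-prev : ∀ f → sumBelow (f ∘ prev) m ≡ sumBelow f m
  sumBelow-prev f = trans (+-comm (f m′) _) (sym (sumBelow-last f m′))

  wrap-next : ∀ s i → i < m → wrap (2 * m) (vertex s i + 2) ≡ vertex s (next i)
  wrap-next s i i<m with suc i <? m
  ... | yes lt rewrite <⇒<ᵇ-true lt | sym (vertex-suc s i) | <⇒<ᵇ-true (vertex-< s (suc i) lt) = refl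
  ... | no ¬lt rewrite ≮⇒<ᵇ-false ¬lt = wrap-last s
    where
    2i+2≡2m : vertex false i + 2 ≡ 2 * m
    2i+2≡2m = trans (sym (vertex-suc false i)) (cong (2 *_) (cong suc (last-column i i<m ¬lt)))
    wrap-last : ∀ s → wrap (2 * m) (vertex s i + 2) ≡ vertex s 0
    wrap-last false rewrite 2i+2≡2m | ≮⇒<ᵇ-false {2 * m} {2 * m} (<-irrefl refl) = n∸n≡0 (2 * m)
    wrap-last true  rewrite 2i+2≡2m | ≮⇒<ᵇ-false {suc (2 * m)} {2 * m} (λ lt → <-irrefl refl (<-trans (n<1+n _) lt)) =
      m+n∸n≡m 1 (2 * m)

  -- endpoints m j ≡ edgeEnds (toℕ j) holds definitionally.
  edgeEnds : ℕ → ℕ × ℕ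
  edgeEnds k = if k <ᵇ m then (2 * k , suc (2 * k)) else (k ∸ m , wrap (2 * m) (k ∸ m + 2))

  rung : ℕ → Bool
  rung i = at I i

  rail : Bool → ℕ → Bool
  rail s i = at I (m + vertex s i)

  active : Bool → ℕ → Bool
  active s i = rail s (prev i) ∨ rung i ∨ rail s i

  rung-index-< : ∀ i → i < m → i < 3 * m
  rung-index-< i i<m = ≤-trans i<m (m≤m+n m _)

  rail-index-< : ∀ s i → i < m → m + vertex s i < 3 * m
  rail-index-< s i i<m = +-monoʳ-< m (vertex-< s i i<m)

  edgeEnds-rung : ∀ i → i < m → edgeEnds i ≡ (vertex false i , vertex true i)
  edgeEnds-rung i i<m rewrite <⇒<ᵇ-true i<m = refl

  edgeEnds-rail : ∀ s i → i < m → edgeEnds (m + vertex s i) ≡ (vertex s i , vertex s (next i))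
  edgeEnds-rail s i i<m
    rewrite ≮⇒<ᵇ-false {m + vertex s i} {m} (λ lt → <-irrefl refl (≤-trans lt (m≤m+n m _)))
          | m+n∸m≡n m (vertex s i) = cong (vertex s i ,_) (wrap-next s i i<m)

  edge-index-cases : ∀ k → k < 3 * m → k < m ⊎ Σ Bool λ s → Σ ℕ λ i → i < m × k ≡ m + vertex s i
  edge-index-cases k k<3m with k <? m
  ... | yes k<m = inj₁ k<m
  ... | no  k≮m with vertex-split (k ∸ m)
  ...   | s , i , e = inj₂ (s , i , i<m , k≡)
    where
    k≡ : k ≡ m + vertex s i
    k≡ = trans (sym (m+[n∸m]≡n (≮⇒≥ k≮m))) (cong (m +_) e)
    i<m : i < m
    i<m = vertex-<⁻ s i (+-cancelˡ-< m _ _ (subst (_< m + 2 * m) k≡ k<3m))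

  Ends : ℕ → ℕ × ℕ → Set
  Ends v (x , y) = v ≡ x ⊎ v ≡ y

  EndOf : ℕ → ℕ → Set
  EndOf v k = Ends v (edgeEnds k)

  isEndOf : ℕ → ℕ → Bool
  isEndOf v k = (v ≡ᵇ proj₁ (edgeEnds k)) ∨ (v ≡ᵇ proj₂ (edgeEnds k))

  joins : ℕ → ℕ → ℕ → Bool
  joins u v k = ((u ≡ᵇ proj₁ (edgeEnds k)) ∧ (v ≡ᵇ proj₂ (edgeEnds k))) ∨ ((u ≡ᵇ proj₂ (edgeEnds k)) ∧ (v ≡ᵇ proj₁ (edgeEnds k)))

  incident-anyBelow : ∀ v → incident m I v ≡ anyBelow (λ k → at I k ∧ isEndOf v k) (3 * m)
  incident-anyBelow v = any-tabulate (λ j → lookup I j ∧ isEndOf v (toℕ j)) id I (isEndOf v) (λ _ → refl)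

  adjI-anyBelow : ∀ u v → adjI m I u v ≡ anyBelow (λ k → at I k ∧ joins u v k) (3 * m)
  adjI-anyBelow u v = any-tabulate (λ j → lookup I j ∧ joins u v (toℕ j)) id I (joins u v) (λ _ → refl)

  incident-intro : ∀ v k → k < 3 * m → at I k ≡ true → EndOf v k → incident m I v ≡ true
  incident-intro v k k<3m e end =
    trans (incident-anyBelow v) (anyBelow-intro (λ k → at I k ∧ isEndOf v k) (3 * m) k k<3m (∧-intro e (is-end end)))
    where
    is-end : EndOf v k → isEndOf v k ≡ true
    is-end (inj₁ refl) = ∨-introˡ _ (≡ᵇ-refl v)
    is-end (inj₂ refl) = ∨-introʳ _ (≡ᵇ-refl v)

  incident-elim : ∀ v → incident m I v ≡ true → Σ ℕ λ k → k < 3 * m × at I k ≡ true × EndOf v k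
  incident-elim v inc with anyBelow-elim (λ k → at I k ∧ isEndOf v k) (3 * m) (trans (sym (incident-anyBelow v)) inc)
  ... | k , k<3m , found with ∧-elim _ _ found
  ...   | e , end with ∨-elim _ _ end
  ...     | inj₁ e₁ = k , k<3m , e , inj₁ (≡ᵇ-true⇒≡ e₁)
  ...     | inj₂ e₂ = k , k<3m , e , inj₂ (≡ᵇ-true⇒≡ e₂)

  adjI-intro : ∀ k → k < 3 * m → at I k ≡ true → adjI m I (proj₁ (edgeEnds k)) (proj₂ (edgeEnds k)) ≡ true
  adjI-intro k k<3m e = trans (adjI-anyBelow u v)
    (anyBelow-intro (λ k → at I k ∧ joins u v k) (3 * m) k k<3m (∧-intro e (∨-introˡ _ (∧-intro (≡ᵇ-refl u) (≡ᵇ-refl v)))))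
    where
    u v : ℕ
    u = proj₁ (edgeEnds k)
    v = proj₂ (edgeEnds k)

  adjI-rung : ∀ s i → i < m → rung i ≡ true → adjI m I (vertex s i) (vertex (not s) i) ≡ true
  adjI-rung false i i<m r = subst (λ e → adjI m I (proj₁ e) (proj₂ e) ≡ true) (edgeEnds-rung i i<m)
    (adjI-intro i (rung-index-< i i<m) r)
  adjI-rung true  i i<m r = trans (adjI-sym (vertex true i) (vertex false i)) (adjI-rung false i i<m r)

  adjI-rail : ∀ s i → i < m → rail s i ≡ true → adjI m I (vertex s i) (vertex s (next i)) ≡ true
  adjI-rail s i i<m e = subst (λ e → adjI m I (proj₁ e) (proj₂ e) ≡ true) (edgeEnds-rail s i i<m)
    (adjI-intro (m + vertex s i) (rail-index-< s i i<m) e)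

  active⇒incident : ∀ s i → i < m → active s i ≡ true → incident m I (vertex s i) ≡ true
  active⇒incident s i i<m a with ∨-elim (rail s (prev i)) _ a
  ... | inj₁ from-left = incident-intro _ (m + vertex s (prev i)) (rail-index-< s (prev i) pi<m) from-left
          (inj₂ (trans (cong (vertex s) (sym (next-prev i i<m))) (cong proj₂ (sym (edgeEnds-rail s (prev i) pi<m)))))
    where
    pi<m : prev i < m
    pi<m = prev-< i i<m
  ... | inj₂ a′ with ∨-elim (rung i) _ a′
  ...   | inj₁ r = incident-intro _ i (rung-index-< i i<m) r (on-rung s)
    where
    on-rung : ∀ s → EndOf (vertex s i) i
    on-rung false = inj₁ (cong proj₁ (sym (edgeEnds-rung i i<m)))
    on-rung true  = inj₂ (cong proj₂ (sym (edgeEnds-rung i i<m)))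
  ...   | inj₂ to-right = incident-intro _ (m + vertex s i) (rail-index-< s i i<m) to-right
          (inj₁ (cong proj₁ (sym (edgeEnds-rail s i i<m))))

  incident⇒active : ∀ s i → i < m → incident m I (vertex s i) ≡ true → active s i ≡ true
  incident⇒active s i i<m inc with incident-elim (vertex s i) inc
  ... | k , k<3m , e , end with edge-index-cases k k<3m
  ...   | inj₁ k<m = [ on-rung false , on-rung true ]′ (subst (Ends (vertex s i)) (edgeEnds-rung k k<m) end)
    where
    on-rung : ∀ t → vertex s i ≡ vertex t k → active s i ≡ true
    on-rung t v≡ = ∨-introʳ (rail s (prev i))
      (∨-introˡ _ (subst (λ j → at I j ≡ true) (sym (proj₂ (vertex-injective s t i k v≡))) e))
  ...   | inj₂ (s′ , i′ , i′<m , k≡) = [ at-start , at-end ]′ (subst (Ends (vertex s i)) ends end)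
    where
    ends : edgeEnds k ≡ (vertex s′ i′ , vertex s′ (next i′))
    ends = trans (cong edgeEnds k≡) (edgeEnds-rail s′ i′ i′<m)
    on : rail s′ i′ ≡ true
    on = subst (λ j → at I j ≡ true) k≡ e
    at-start : vertex s i ≡ vertex s′ i′ → active s i ≡ true
    at-start v≡ with vertex-injective s s′ i i′ v≡
    ... | s≡ , i≡ = ∨-introʳ (rail s (prev i)) (∨-introʳ (rung i) (subst₂ (λ s j → rail s j ≡ true) (sym s≡) (sym i≡) on))
    at-end : vertex s i ≡ vertex s′ (next i′) → active s i ≡ true
    at-end v≡ with vertex-injective s s′ i (next i′) v≡
    ... | s≡ , i≡ = ∨-introˡ _
      (subst₂ (λ s j → rail s j ≡ true) (sym s≡) (trans (sym (prev-next i′ i′<m)) (cong prev (sym i≡))) on)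

  incident-vertex : ∀ s i → i < m → incident m I (vertex s i) ≡ active s i
  incident-vertex s i i<m = ≡true-ext _ _ (incident⇒active s i i<m) (active⇒incident s i i<m)

  railsAt : ℕ → ℕ
  railsAt i = 𝟙 (rail false i) + 𝟙 (rail true i)

  numEdges-columns : numEdges m I ≡ countBelow rung m + sumBelow railsAt m
  numEdges-columns = begin
    numEdges m I                                                    ≡⟨ length-filterᵇ-tabulate (lookup I) id I (λ _ → refl) ⟩
    countBelow (at I) (m + 2 * m)                                   ≡⟨ sumBelow-split (𝟙 ∘ at I) m (2 * m) ⟩
    countBelow rung m + sumBelow (λ k → 𝟙 (at I (m + k))) (2 * m)
      ≡⟨ cong (countBelow rung m +_) (sumBelow-columns (λ k → 𝟙 (at I (m + k))) m) ⟩
    countBelow rung m + sumBelow railsAt m                          ∎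
    where open ≡-Reasoning

  -- Every rail is counted once from each of its two columns.
  twice-numEdges : 2 * numEdges m I ≡ sumBelow (λ i → 2 * 𝟙 (rung i) + railsAt (prev i) + railsAt i) m
  twice-numEdges = begin
    2 * numEdges m I                                  ≡⟨ cong (2 *_) numEdges-columns ⟩
    2 * (countBelow rung m + H)                       ≡⟨ *-distribˡ-+ 2 (countBelow rung m) H ⟩
    2 * countBelow rung m + 2 * H
      ≡⟨ cong₂ _+_ (sym (sumBelow-* 2 (𝟙 ∘ rung) m)) (cong (H +_) (+-identityʳ H)) ⟩
    sumBelow twiceRung m + (H + H)
      ≡⟨ cong (λ x → sumBelow twiceRung m + (x + H)) (sym (sumBelow-prev railsAt)) ⟩
    sumBelow twiceRung m + (sumBelow (railsAt ∘ prev) m + H)  ≡⟨ sym (+-assoc (sumBelow twiceRung m) _ H) ⟩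
    sumBelow twiceRung m + sumBelow (railsAt ∘ prev) m + H
      ≡⟨ sym (trans (sumBelow-+ (λ i → twiceRung i + railsAt (prev i)) railsAt m)
                    (cong (_+ H) (sumBelow-+ twiceRung (railsAt ∘ prev) m))) ⟩
    sumBelow (λ i → 2 * 𝟙 (rung i) + railsAt (prev i) + railsAt i) m ∎
    where
    open ≡-Reasoning
    H : ℕ
    H = sumBelow railsAt m
    twiceRung : ℕ → ℕ
    twiceRung i = 2 * 𝟙 (rung i)

  activeAt : ℕ → ℕ
  activeAt i = 𝟙 (active false i) + 𝟙 (active true i)

  numVertices-columns : numVertices m I ≡ sumBelow activeAt m
  numVertices-columns = begin
    numVertices m I                        ≡⟨ length-filterᵇ-applyUpTo (incident m I) id (2 * m) ⟩
    countBelow (incident m I) (2 * m)      ≡⟨ sumBelow-columns (𝟙 ∘ incident m I) m ⟩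
    sumBelow (λ i → 𝟙 (incident m I (vertex false i)) + 𝟙 (incident m I (vertex true i))) m
      ≡⟨ sumBelow-cong _ activeAt m (λ i i<m →
           cong₂ _+_ (cong 𝟙 (incident-vertex false i i<m)) (cong 𝟙 (incident-vertex true i i<m))) ⟩
    sumBelow activeAt m                    ∎
    where open ≡-Reasoning

  leftEnd rightEnd : Bool → ℕ → Bool
  leftEnd  s i = leftEndIn  s (rail false (prev i)) (rail true (prev i)) (rung i) (rail false i) (rail true i)
  rightEnd s i = rightEndIn s (rail false (prev i)) (rail true (prev i)) (rung i) (rail false i) (rail true i)

  endCount : (Bool → ℕ → Bool) → ℕ
  endCount end = countBelow (onVertices end) (2 * m)

  ends-inequality : 2 * endCount leftEnd + 2 * endCount rightEnd + 2 * numEdges m I ≤ 3 * numVertices m I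
  ends-inequality = begin
    2 * endCount leftEnd + 2 * endCount rightEnd + 2 * numEdges m I
      ≡⟨ cong₂ _+_ (cong₂ _+_ (twice leftEnd) (twice rightEnd)) twice-numEdges ⟩
    sumBelow (λ i → 2 * ends leftEnd i) m + sumBelow (λ i → 2 * ends rightEnd i) m + sumBelow edgeWeight m
      ≡⟨ sym (trans (sumBelow-+ (λ i → 2 * ends leftEnd i + 2 * ends rightEnd i) edgeWeight m)
                    (cong (_+ sumBelow edgeWeight m) (sumBelow-+ (λ i → 2 * ends leftEnd i) (λ i → 2 * ends rightEnd i) m))) ⟩
    sumBelow (λ i → 2 * ends leftEnd i + 2 * ends rightEnd i + edgeWeight i) m
      ≤⟨ sumBelow-mono _ _ m (λ i _ →
           column-inequality (rail false (prev i)) (rail true (prev i)) (rung i) (rail false i) (rail true i)) ⟩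
    sumBelow (λ i → 3 * activeAt i) m
      ≡⟨ sumBelow-* 3 activeAt m ⟩
    3 * sumBelow activeAt m
      ≡⟨ cong (3 *_) (sym numVertices-columns) ⟩
    3 * numVertices m I ∎
    where
    open ≤-Reasoning
    ends : (Bool → ℕ → Bool) → ℕ → ℕ
    ends end i = 𝟙 (end false i) + 𝟙 (end true i)
    edgeWeight : ℕ → ℕ
    edgeWeight i = 2 * 𝟙 (rung i) + railsAt (prev i) + railsAt i
    twice : ∀ end → 2 * endCount end ≡ sumBelow (λ i → 2 * ends end i) m
    twice end = trans (cong (2 *_) (countBelow-onVertices end m)) (sym (sumBelow-* 2 (ends end) m))

  Connected-rung : ∀ s i → i < m → rung i ≡ true → Connected (vertex s i) (vertex (not s) i)
  Connected-rung s i i<m r = adjI⇒Connected (vertex-< s i i<m) (adjI-rung s i i<m r)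

  Connected-top : ∀ s i → i < m → rung i ≡ true → Connected (vertex s i) (vertex false i)
  Connected-top false i i<m r = Connected-refl _
  Connected-top true  i i<m r = Connected-rung true i i<m r

  -- A direction along the rails: `end s i` marks the vertices at which a component of I stops when
  -- one walks in this direction.
  record Direction : Set where
    field
      step          : ℕ → ℕ
      step-<        : ∀ i → i < m → step i < m
      railTo        : Bool → ℕ → Bool
      railTo-adjI   : ∀ s i → i < m → railTo s i ≡ true → adjI m I (vertex s i) (vertex s (step i)) ≡ true
      railTo-active : ∀ s i → i < m → railTo s i ≡ true → active s (step i) ≡ true
      end           : Bool → ℕ → Bool
      end-no-rung   : ∀ s i → rung i ≡ false → railTo s i ≡ false → active s i ≡ true → end s i ≡ true
      end-rung      : ∀ s i → rung i ≡ true → railTo s i ≡ false → railTo (not s) i ≡ false → end false i ≡ true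

  left : Direction
  left = record
    { step          = prev
    ; step-<        = prev-<
    ; railTo        = λ s i → rail s (prev i)
    ; railTo-adjI   = λ s i i<m e → trans (adjI-sym (vertex s i) (vertex s (prev i)))
                        (subst (λ j → adjI m I (vertex s (prev i)) (vertex s j) ≡ true) (next-prev i i<m)
                          (adjI-rail s (prev i) (prev-< i i<m) e))
    ; railTo-active = λ s i _ e → ∨-introʳ (rail s (prev (prev i))) (∨-introʳ (rung (prev i)) e)
    ; end           = leftEnd
    ; end-no-rung   = end-no-rung
    ; end-rung      = end-rung
    }
    where
    end-no-rung : ∀ s i → rung i ≡ false → rail s (prev i) ≡ false → active s i ≡ true → leftEnd s i ≡ true
    end-no-rung false i r e a rewrite r | e = a
    end-no-rung true  i r e a rewrite r | e = a
    end-rung : ∀ s i → rung i ≡ true → rail s (prev i) ≡ false → rail (not s) (prev i) ≡ false → leftEnd false i ≡ true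
    end-rung false i r e e′ rewrite r | e | e′ = refl
    end-rung true  i r e e′ rewrite r | e | e′ = refl

  right : Direction
  right = record
    { step          = next
    ; step-<        = next-<
    ; railTo        = rail
    ; railTo-adjI   = adjI-rail
    ; railTo-active = λ s i i<m e → ∨-introˡ _ (subst (λ j → rail s j ≡ true) (sym (prev-next i i<m)) e)
    ; end           = rightEnd
    ; end-no-rung   = end-no-rung
    ; end-rung      = end-rung
    }
    where
    end-no-rung : ∀ s i → rung i ≡ false → rail s i ≡ false → active s i ≡ true → rightEnd s i ≡ true
    end-no-rung false i r e a rewrite r | e = trans (sym (∨-identityʳ _)) a
    end-no-rung true  i r e a rewrite r | e = trans (sym (∨-identityʳ _)) a
    end-rung : ∀ s i → rung i ≡ true → rail s i ≡ false → rail (not s) i ≡ false → rightEnd false i ≡ true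
    end-rung false i r e e′ rewrite r | e | e′ = refl
    end-rung true  i r e e′ rewrite r | e | e′ = refl

  module Walk (d : Direction) (dist : ℕ → ℕ)
              (dist-step : ∀ s i → i < m → Direction.railTo d s i ≡ true → dist (Direction.step d i) < dist i) where
    open Direction d

    ReachesEnd : Bool → ℕ → Set
    ReachesEnd s i = Σ Bool λ s′ → Σ ℕ λ j → j < m × end s′ j ≡ true × Connected (vertex s i) (vertex s′ j)

    extend : ∀ s i s₁ i₁ → Connected (vertex s i) (vertex s₁ i₁) → ReachesEnd s₁ i₁ → ReachesEnd s i
    extend _ _ _ _ c (s′ , j , j<m , e , c′) = s′ , j , j<m , e , Connected-trans c c′

    along-rail : ∀ s i → i < m → railTo s i ≡ true → Connected (vertex s i) (vertex s (step i))
    along-rail s i i<m e = adjI⇒Connected (vertex-< s i i<m) (railTo-adjI s i i<m e)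

    reaches-end : ∀ fuel s i → i < m → dist i < fuel → active s i ≡ true → ReachesEnd s i
    reaches-end (suc fuel) s i i<m lt a with true-or-false (railTo s i)
    ... | inj₁ e = extend s i s (step i) (along-rail s i i<m e)
                     (reaches-end fuel s (step i) (step-< i i<m) (≤-trans (dist-step s i i<m e) (≤-pred lt))
                                  (railTo-active s i i<m e))
    ... | inj₂ e with true-or-false (rung i)
    ...   | inj₂ r = s , i , i<m , end-no-rung s i r e a , Connected-refl _
    ...   | inj₁ r with true-or-false (railTo (not s) i)
    ...     | inj₂ e′ = false , i , i<m , end-rung s i r e e′ , Connected-top s i i<m r
    ...     | inj₁ e′ = extend s i (not s) (step i)
                          (Connected-trans (Connected-rung s i i<m r) (along-rail (not s) i i<m e′))
                          (reaches-end fuel (not s) (step i) (step-< i i<m)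
                                       (≤-trans (dist-step (not s) i i<m e′) (≤-pred lt)) (railTo-active (not s) i i<m e′))

  numComponents≤endCount : (d : Direction) (dist : ℕ → ℕ) →
    (∀ s i → i < m → Direction.railTo d s i ≡ true → dist (Direction.step d i) < dist i) →
    numComponents m I ≤ endCount (Direction.end d)
  numComponents≤endCount d dist dist-step = subst (_≤ endCount (Direction.end d)) (sym numComponents-count)
    (countBelow-injection isRepresentative (onVertices (Direction.end d)) (2 * m) (2 * m) EndIn has-end distinct)
    where
    open Walk d dist dist-step
    EndIn : ℕ → ℕ → Set
    EndIn v t = t < 2 * m × Connected v t
    has-end : ∀ v → v < 2 * m → isRepresentative v ≡ true →
      Σ ℕ λ t → t < 2 * m × onVertices (Direction.end d) t ≡ true × EndIn v t
    has-end v v<2m rep with vertex-split v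
    ... | s , i , refl with reaches-end (suc (dist i)) s i i<m ≤-refl
                              (trans (sym (incident-vertex s i i<m)) (proj₁ (∧-elim _ _ rep)))
      where
      i<m : i < m
      i<m = vertex-<⁻ s i v<2m
    ...   | s′ , j , j<m , e , c =
      vertex s′ j , vertex-< s′ j j<m , trans (onVertices-vertex (Direction.end d) s′ j) e , vertex-< s′ j j<m , c
    distinct : InjectiveBelow isRepresentative (2 * m) EndIn
    distinct v w t v<2m w<2m rep-v rep-w (_ , c-v) (t<2m , c-w) =
      representative-unique v<2m w<2m rep-v rep-w (Connected-trans c-v (Connected-sym w<2m t<2m c-w))

  rail-gap : numEdges m I < m → Σ ℕ λ g → g < m × (∀ s → rail s g ≡ false)
  rail-gap ℓ<m with small-sum⇒zero-term railsAt m
                      (≤-<-trans (m≤n+m _ (countBelow rung m)) (subst (_< m) numEdges-columns ℓ<m))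
  ... | g , g<m , none = g , g<m , no-rail
    where
    no-rail : ∀ s → rail s g ≡ false
    no-rail false = proj₁ (𝟙+𝟙≡0 _ _ none)
    no-rail true  = proj₂ (𝟙+𝟙≡0 _ _ none)

  module Gap (g : ℕ) (g<m : g < m) (no-rail : ∀ s → rail s g ≡ false) where

    rail-avoids-gap : ∀ s j → rail s j ≡ true → j ≢ g
    rail-avoids-gap s j e refl = true≢false (trans (sym e) (no-rail s))

    -- Number of steps from column i to the gap: leftwards to column g + 1, rightwards to column g.
    leftDist : ℕ → ℕ
    leftDist i with i ≤? g
    ... | yes _ = i + m ∸ suc g
    ... | no  _ = i ∸ suc g

    rightDist : ℕ → ℕ
    rightDist i with i ≤? g
    ... | yes _ = g ∸ i
    ... | no  _ = g + m ∸ i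

    leftDist-prev : ∀ i → prev i ≢ g → leftDist (prev i) < leftDist i
    leftDist-prev zero ne with 0 ≤? g | m′ ≤? g
    ... | no ¬p | _     = ⊥-elim (¬p z≤n)
    ... | yes _ | yes q = ⊥-elim (ne (≤-antisym q (≤-pred g<m)))
    ... | yes _ | no ¬q = ∸-monoʳ-< ≤-refl (≰⇒> ¬q)
    leftDist-prev (suc i) ne with suc i ≤? g | i ≤? g
    ... | yes p | yes q = ∸-monoʳ-< ≤-refl (≤-trans g<m (m≤n+m m i))
    ... | yes p | no ¬q = ⊥-elim (¬q (≤-trans (n≤1+n i) p))
    ... | no ¬p | yes q = ⊥-elim (ne (≤-antisym q (≤-pred (≰⇒> ¬p))))
    ... | no ¬p | no ¬q = ∸-monoʳ-< ≤-refl (≰⇒> ¬q)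

    rightDist-next : ∀ i → i < m → i ≢ g → rightDist (next i) < rightDist i
    rightDist-next i i<m ne with suc i <? m
    ... | yes lt rewrite <⇒<ᵇ-true lt = inner
      where
      inner : rightDist (suc i) < rightDist i
      inner with i ≤? g | suc i ≤? g
      ... | yes p | yes q = ∸-monoʳ-< (n<1+n i) q
      ... | yes p | no ¬q = ⊥-elim (¬q (≤∧≢⇒< p ne))
      ... | no ¬p | yes q = ⊥-elim (¬p (≤-trans (n≤1+n i) q))
      ... | no ¬p | no ¬q = ∸-monoʳ-< (n<1+n i) (≤-trans (<⇒≤ lt) (m≤n+m m g))
    ... | no ¬lt rewrite ≮⇒<ᵇ-false ¬lt = wrapped
      where
      wrapped : rightDist 0 < rightDist i
      wrapped with 0 ≤? g | i ≤? g
      ... | no ¬p | _     = ⊥-elim (¬p z≤n)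
      ... | yes _ | yes q = ⊥-elim (ne (≤-antisym q (subst (g ≤_) (sym (last-column i i<m ¬lt)) (≤-pred g<m))))
      ... | yes _ | no ¬q rewrite last-column i i<m ¬lt | +-suc g m′ | m+n∸n≡m (suc g) m′ = ≤-refl

    numComponents≤leftEnds : numComponents m I ≤ endCount leftEnd
    numComponents≤leftEnds = numComponents≤endCount left leftDist
      λ s i _ e → leftDist-prev i (rail-avoids-gap s (prev i) e)

    numComponents≤rightEnds : numComponents m I ≤ endCount rightEnd
    numComponents≤rightEnds = numComponents≤endCount right rightDist
      λ s i i<m e → rightDist-next i i<m (rail-avoids-gap s i e)

  ladder-bound : numEdges m I < m → 2 * numEdges m I + 4 * numComponents m I ≤ 3 * numVertices m I
  ladder-bound ℓ<m = begin
    2 * ℓ + 4 * c                                          ≡⟨ +-comm (2 * ℓ) (4 * c) ⟩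
    4 * c + 2 * ℓ                                          ≡⟨ cong (_+ 2 * ℓ) (*-distribʳ-+ c 2 2) ⟩
    2 * c + 2 * c + 2 * ℓ
      ≤⟨ +-monoˡ-≤ (2 * ℓ) (+-mono-≤ (*-monoʳ-≤ 2 numComponents≤leftEnds) (*-monoʳ-≤ 2 numComponents≤rightEnds)) ⟩
    2 * endCount leftEnd + 2 * endCount rightEnd + 2 * ℓ   ≤⟨ ends-inequality ⟩
    3 * numVertices m I                                    ∎
    where
    open ≤-Reasoning
    ℓ c : ℕ
    ℓ = numEdges m I
    c = numComponents m I
    gap : Σ ℕ λ g → g < m × (∀ s → rail s g ≡ false)
    gap = rail-gap ℓ<m
    open Gap (proj₁ gap) (proj₁ (proj₂ gap)) (proj₂ (proj₂ gap))

fewer-edges-than-columns : ∀ ℓ m′ → 10 * ℓ ≤ 2 * suc m′ → ℓ < suc m′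
fewer-edges-than-columns ℓ m′ 10ℓ≤2m with ℓ <? suc m′
... | yes ℓ<m = ℓ<m
... | no  ℓ≮m = ⊥-elim (10≰2 (*-cancelʳ-≤ 10 2 (suc m′) (≤-trans (*-monoʳ-≤ 10 (≮⇒≥ ℓ≮m)) 10ℓ≤2m)))
  where
  10≰2 : ¬ (10 ≤ 2)
  10≰2 (s≤s (s≤s ()))

lemma3p1 : (m : ℕ) → 3 ≤ m → (I : EdgeSet m) →
             10 * numEdges m I ≤ 2 * m →
             2 * numEdges m I + 4 * numComponents m I ≤ 3 * numVertices m I
lemma3p1 (suc m′) _ I 10ℓ≤2m = Ladder.ladder-bound m′ I (fewer-edges-than-columns (numEdges (suc m′) I) m′ 10ℓ≤2m)
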